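{- Let $(X,S,G,\mathcal{B})$ be an $n$-dimensional building-like complex. Then there exists a family of $\mathbb{F}_2$-chains $$\mathcal{C}=\{c_{s,\tau}\in C_{k+1}(B_{s,\tau}) : -1\le k\le n-1,\ (s,\tau)\in S\times X(k)\}$$ such that for every $-1\le k\le n-1$ and $(s,\tau)\in S\times X(k)$, writing $\tau=(v_0,\dots,v_k)$ and $\tau_i=(v_0,\dots,v_{i-1},v_{i+1},\dots,v_k)$, $$\partial_{k+1}c_{s,\tau}=\tau+\sum_{i=0}^{k}c_{s,\tau_i}.$$
   Context: All chains are with $\mathbb{F}_2$ coefficients; $C_k(Y)$ is the space of $k$-chains of a complex $Y$ with boundary map $\partial_k$, using the augmented convention: $X(-1)=\{\emptyset\}$, $C_{ -1}$ is spanned by the empty simplex, and $\partial_0 v=\emptyset$ for each vertex $v$ (for $k=-1$ the sum over $i$ is empty). A building-like complex is a 4-tuple $(X,S,G,\mathcal{B})$ where $X$ is a finite pure $n$-dimensional simplicial complex ($X(k)$ its set of $k$-faces, $X^{(k)}$ its $k$-skeleton), $G$ is a subgroup of the automorphism group of $X$, $S$ is a finite $G$-set, $\mathcal{F}_k=S\times X(k)$ with diagonal $G$-action, and $\mathcal{B}=\{B_{s,\tau}: -1\le k<n,\ (s,\tau)\in\mathcal{F}_k\}$ is a family of subcomplexes of $X$ with $\tau\in B_{s,\tau}\subset B_{s,\tau'}$ for all $s\in S$ and $\tau\subset\tau'\in X^{(n-1)}$, satisfying: (C1) $G$ acts transitively on $X(n)$; (C2) $gB_{s,\tau}=B_{gs,g\tau}$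 for all $g\in G$, $(s,\tau)\in S\times X^{(n-1)}$; (C3) $\tilde H_i(B_{s,\tau};\mathbb{F}_2)=0$ for all $(s,\tau)\in\mathcal{F}_k$ and $-1\le i\le k<n$. -}

module Defs where

open import Data.Nat using (ℕ; zero; suc; _≤_)
open import Data.Bool using (Bool; true; false; _xor_; _∧_; not; if_then_else_)
open import Data.Bool.Properties using () renaming (_≟_ to _≟ᵇ_)
open import Data.Fin using (Fin; zero; suc)
open import Data.Fin.Subset using (Subset; _⊆_; ∣_∣; ⁅_⁆; _-_)
open import Data.Fin.Permutation using (Permutation′; _⟨$⟩ʳ_; _⟨$⟩ˡ_; id; flip; _∘ₚ_)
open import Data.Vec using (lookup; tabulate; _[_]≔_)
open import Data.Vec.Properties using (≡-dec)
open import Data.Product using (Σ; ∃; _×_; _,_)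
open import Relation.Binary.PropositionalEquality using (_≡_)
open import Relation.Nullary.Decidable using (⌊_⌋)

-- Simplicial complexes on the vertex set Fin V.
-- A face is a subset of Fin V; a k-face has k+1 vertices.
-- Augmented convention: the empty subset is the unique (-1)-face.

record Complex (V : ℕ) : Set where
  field
    face      : Subset V → Bool
    downClose : ∀ {σ ρ} → face σ ≡ true → ρ ⊆ σ → face ρ ≡ true
open Complex public

_≤ᶜ_ : ∀ {V} → Complex V → Complex V → Set
Y ≤ᶜ Z = ∀ σ → face Y σ ≡ true → face Z σ ≡ true

Pure : ∀ {V} → ℕ → Complex V → Set
Pure {V} n X =
  (∃ λ σ → face X σ ≡ true × ∣ σ ∣ ≡ suc n)
  × (∀ σ → face X σ ≡ true → ∣ σ ∣ ≤ suc n)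
  × (∀ σ → face X σ ≡ true →
       ∃ λ ρ → face X ρ ≡ true × ∣ ρ ∣ ≡ suc n × σ ⊆ ρ)

img : ∀ {V} → Permutation′ V → Subset V → Subset V
img g σ = tabulate (λ j → lookup σ (g ⟨$⟩ˡ j))

IsAut : ∀ {V} → Complex V → Permutation′ V → Set
IsAut X g = ∀ σ → face X (img g σ) ≡ face X σ

-- F₂-chains: a chain is its (finite) support, i.e. a function
-- Subset V → Bool.  c ∈ C_k(Y) iff its support consists of k-faces
-- of Y, i.e. faces of Y with d = k+1 vertices.

Chain : ℕ → Set
Chain V = Subset V → Bool

InC : ∀ {V} → (d : ℕ) → Complex V → Chain V → Set
InC d Y c = ∀ σ → c σ ≡ true → face Y σ ≡ true × ∣ σ ∣ ≡ d

xorSum : ∀ {V} → (Fin V → Bool) → Bool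
xorSum {zero}  f = false
xorSum {suc V} f = f zero xor xorSum (λ i → f (suc i))

-- boundary map with F₂ coefficients (augmented: ∂ v = ∅):
-- the coefficient of σ in ∂c is the sum of c(σ ∪ {v}) over v ∉ σ.
∂ : ∀ {V} → Chain V → Chain V
∂ c σ = xorSum (λ v → not (lookup σ v) ∧ c (σ [ v ]≔ true))

⟦_⟧ : ∀ {V} → Subset V → Chain V
⟦ τ ⟧ σ = ⌊ ≡-dec _≟ᵇ_ σ τ ⌋

-- H̃_{d-1}(Y; F₂) = 0 : every (d-1)-cycle of Y is a boundary of a d-chain of Y
ReducedHomologyVanishes : ∀ {V} → Complex V → (d : ℕ) → Set
ReducedHomologyVanishes Y d =
  ∀ c → InC d Y c → (∀ σ → ∂ c σ ≡ false) →
  ∃ λ b → InC (suc d) Y b × (∀ σ → ∂ b σ ≡ c σ)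

-- Building-like complexes (X,S,G,𝓑) of dimension n, with vertex set
-- Fin V for X and S = Fin m.  G is a subgroup of Aut(X), given by a
-- membership predicate on vertex permutations.

record BuildingLike (V n m : ℕ) : Set₁ where
  field
    X      : Complex V
    X-pure : Pure n X
    X-vert : ∀ v → face X ⁅ v ⁆ ≡ true

    inG    : Permutation′ V → Set
    G-aut  : ∀ g → inG g → IsAut X g
    G-id   : inG id
    G-comp : ∀ g h → inG g → inG h → inG (h ∘ₚ g)   -- h ∘ₚ g is the map g ∘ h
    G-inv  : ∀ g → inG g → inG (flip g)

    act      : (g : Permutation′ V) → inG g → Fin m → Fin m
    act-id   : ∀ s → act id G-id s ≡ s
    act-comp : ∀ g h (p : inG g) (q : inG h) s →
               act (h ∘ₚ g) (G-comp g h p q) s ≡ act g p (act h q s)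

    -- the family 𝓑 (only its values at faces τ ∈ X^{(n-1)} matter)
    B      : Fin m → Subset V → Complex V
    B-sub  : ∀ s τ → face X τ ≡ true → ∣ τ ∣ ≤ n → B s τ ≤ᶜ X
    B-mem  : ∀ s τ → face X τ ≡ true → ∣ τ ∣ ≤ n → face (B s τ) τ ≡ true
    B-mono : ∀ s τ τ′ → face X τ′ ≡ true → ∣ τ′ ∣ ≤ n → τ ⊆ τ′ →
             B s τ ≤ᶜ B s τ′

    C1 : ∀ σ σ′ → face X σ ≡ true → ∣ σ ∣ ≡ suc n →
         face X σ′ ≡ true → ∣ σ′ ∣ ≡ suc n →
         ∃ λ g → inG g × img g σ ≡ σ′
    C2 : ∀ g (p : inG g) s τ → face X τ ≡ true → ∣ τ ∣ ≤ n →
         ∀ σ → face (B (act g p s) (img g τ)) (img g σ) ≡ face (B s τ) σ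
    -- (C3) H̃_i(B_{s,τ}) = 0 for τ ∈ X(k), -1 ≤ i ≤ k < n  (d = i+1)
    C3 : ∀ s τ → face X τ ≡ true → ∣ τ ∣ ≤ n →
         ∀ d → d ≤ ∣ τ ∣ → ReducedHomologyVanishes (B s τ) d

-- The chains are built by induction on dim τ, separately for each s.  Once every facet
-- τ - v carries a chain c(τ - v) with the required boundary, the chain
-- τ + Σ_{v ∈ τ} c(τ - v) is a cycle: its boundary is Σ_v (τ - v) + Σ_v ∂c(τ - v), and
-- expanding ∂c(τ - v) leaves a sum over codimension-2 faces in which τ - v - w = τ - w - v
-- appears twice.  It is supported in B_{s,τ} because the B's are nested, so by (C3) in
-- degree dim τ it bounds a chain of B_{s,τ}, which we take as c_{s,τ}.
module Submission where

open import Defs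
open import Data.Nat using (ℕ; suc; _≤_)
open import Data.Bool using (true; _xor_; _∧_)
open import Data.Fin using (Fin)
open import Data.Fin.Subset using (Subset; ∣_∣; _-_)
open import Data.Vec using (lookup)
open import Data.Product using (∃; _×_)
open import Relation.Binary.PropositionalEquality using (_≡_)

open import Algebra.Bundles using (CommutativeRing)
open import Data.Nat using (zero; _<_; s≤s)
open import Data.Nat.Properties
  using (≤-trans; ≤-refl; ≤-reflexive; ≤-pred; <⇒≤; <-≤-trans; <⇒≢; m≤n⇒m<n∨m≡n; _≤?_)
  renaming (_≟_ to _≟ℕ_)
open import Data.Bool using (Bool; false; not)
open import Data.Bool.Properties
  using (xor-∧-commutativeRing; xor-assoc; xor-same; ∧-distribˡ-xor; ∧-zeroʳ) renaming (_≟_ to _≟ᵇ_)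
open import Data.Fin using (zero; suc)
import Data.Fin.Properties as Fin
open import Data.Fin.Subset using (_⊆_; ⁅_⁆)
open import Data.Fin.Subset.Properties
  using (x∈p⇒∣p-x∣<∣p∣; p─⊥≡p; p─q⊆p; p─x─y≡p─y─x; p⊆q⇒∣p∣≤∣q∣)
open import Data.Vec using (_∷_; _[_]≔_)
open import Data.Vec.Properties
  using (≡-dec; lookup⇒[]=; lookup∘update; lookup∘update′; []≔-idempotent; []≔-lookup)
open import Data.Product using (_,_; proj₁; proj₂)
open import Data.Sum using (_⊎_; inj₁; inj₂)
open import Data.Empty using (⊥-elim)
open import Function using (_∘_)
open import Relation.Nullary using (Dec; yes; no)
open import Relation.Nullary.Decidable using (_×-dec_)
open import Relation.Binary.PropositionalEquality
  using (refl; sym; trans; cong; cong₂; subst; _≢_; module ≡-Reasoning)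

open CommutativeRing xor-∧-commutativeRing using (+-commutativeSemigroup; *-commutativeSemigroup)
open import Algebra.Properties.CommutativeSemigroup +-commutativeSemigroup
  using () renaming (interchange to xor-interchange)
open import Algebra.Properties.CommutativeSemigroup *-commutativeSemigroup
  using () renaming (x∙yz≈y∙xz to ∧-lcomm)

xor-cancelˡ : ∀ a b → a xor (a xor b) ≡ b
xor-cancelˡ a b = trans (sym (xor-assoc a a b)) (cong (_xor b) (xor-same a))

true≢false : true ≢ false
true≢false ()

xor≡true : ∀ a b → a xor b ≡ true → a ≡ true ⊎ b ≡ true
xor≡true true  b _ = inj₁ refl
xor≡true false b p = inj₂ p

xorSum-cong : ∀ {V} {f g : Fin V → Bool} → (∀ i → f i ≡ g i) → xorSum f ≡ xorSum g
xorSum-cong {zero}  f≗g = refl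
xorSum-cong {suc V} f≗g = cong₂ _xor_ (f≗g zero) (xorSum-cong (λ i → f≗g (suc i)))

xorSum-false : ∀ {V} → xorSum {V} (λ _ → false) ≡ false
xorSum-false {zero}  = refl
xorSum-false {suc V} = xorSum-false {V}

xorSum-xor : ∀ {V} (f g : Fin V → Bool) →
  xorSum (λ i → f i xor g i) ≡ xorSum f xor xorSum g
xorSum-xor {zero}  f g = refl
xorSum-xor {suc V} f g =
  trans (cong ((f zero xor g zero) xor_) (xorSum-xor (λ i → f (suc i)) (λ i → g (suc i))))
        (xor-interchange (f zero) (g zero) _ _)

xorSum-∧ : ∀ {V} a (f : Fin V → Bool) → xorSum (λ i → a ∧ f i) ≡ a ∧ xorSum f
xorSum-∧     true  f = refl
xorSum-∧ {V} false f = xorSum-false {V}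

xorSum-swap : ∀ {V W} (f : Fin V → Fin W → Bool) →
  xorSum (λ i → xorSum (f i)) ≡ xorSum (λ j → xorSum (λ i → f i j))
xorSum-swap {zero} {W} f = sym (xorSum-false {W})
xorSum-swap {suc V} f =
  trans (cong (xorSum (f zero) xor_) (xorSum-swap (λ i → f (suc i))))
        (sym (xorSum-xor (f zero) (λ j → xorSum (λ i → f (suc i) j))))

xorSum-symmetric≡false : ∀ {V} (f : Fin V → Fin V → Bool) →
  (∀ i j → f i j ≡ f j i) → (∀ i → f i i ≡ false) →
  xorSum (λ i → xorSum (f i)) ≡ false
xorSum-symmetric≡false {zero}  f sym-f diag-f = refl
xorSum-symmetric≡false {suc V} f sym-f diag-f = begin
  (f zero zero xor row) xor xorSum (λ i → f (suc i) zero xor xorSum (f′ i))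
    ≡⟨ cong₂ _xor_ (cong (_xor row) (diag-f zero)) (xorSum-xor (λ i → f (suc i) zero) (λ i → xorSum (f′ i))) ⟩
  row xor (xorSum (λ i → f (suc i) zero) xor xorSum (λ i → xorSum (f′ i)))
    ≡⟨ cong (λ col → row xor (col xor xorSum (λ i → xorSum (f′ i)))) (xorSum-cong {V} (λ i → sym-f (suc i) zero)) ⟩
  row xor (row xor xorSum (λ i → xorSum (f′ i)))
    ≡⟨ xor-cancelˡ row _ ⟩
  xorSum (λ i → xorSum (f′ i))
    ≡⟨ xorSum-symmetric≡false f′ (λ i j → sym-f (suc i) (suc j)) (λ i → diag-f (suc i)) ⟩
  false ∎
  where
  open ≡-Reasoning
  row = xorSum (λ j → f zero (suc j))
  f′ = λ i j → f (suc i) (suc j)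

xorSum≡true⇒∃ : ∀ {V} (f : Fin V → Bool) → xorSum f ≡ true → ∃ λ i → f i ≡ true
xorSum≡true⇒∃ {suc V} f sum≡true with f zero in f₀ | xor≡true (f zero) _ sum≡true
... | true | _      = zero , f₀
... | false | inj₂ p = let i , fi = xorSum≡true⇒∃ (λ i → f (suc i)) p in suc i , fi

p-x≡p[x]≔false : ∀ {V} (p : Subset V) x → p - x ≡ p [ x ]≔ false
p-x≡p[x]≔false (b ∷ p) zero    = cong (false ∷_) (p─⊥≡p p)
p-x≡p[x]≔false (b ∷ p) (suc x) = cong (b ∷_) (p-x≡p[x]≔false p x)

lookup-x[p-x] : ∀ {V} (p : Subset V) x → lookup (p - x) x ≡ false
lookup-x[p-x] p x = trans (cong (λ q → lookup q x) (p-x≡p[x]≔false p x)) (lookup∘update x p false)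

lookup-y[p-x] : ∀ {V} (p : Subset V) {x y} → y ≢ x → lookup (p - x) y ≡ lookup p y
lookup-y[p-x] p {x} {y} y≢x = trans (cong (λ q → lookup q y) (p-x≡p[x]≔false p x)) (lookup∘update′ y≢x p false)

∣p[x]≔false∣ : ∀ {V} (p : Subset V) x → lookup p x ≡ true → suc ∣ p [ x ]≔ false ∣ ≡ ∣ p ∣
∣p[x]≔false∣ (true ∷ p)  zero    _    = refl
∣p[x]≔false∣ (true ∷ p)  (suc x) x∈p = cong suc (∣p[x]≔false∣ p x x∈p)
∣p[x]≔false∣ (false ∷ p) (suc x) x∈p = ∣p[x]≔false∣ p x x∈p

p-x⊆p : ∀ {V} (p : Subset V) x → p - x ⊆ p
p-x⊆p p x = p─q⊆p p ⁅ x ⁆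

∣p-x∣+1≡∣p∣ : ∀ {V} (p : Subset V) x → lookup p x ≡ true → suc ∣ p - x ∣ ≡ ∣ p ∣
∣p-x∣+1≡∣p∣ p x x∈p = trans (cong (λ q → suc ∣ q ∣) (p-x≡p[x]≔false p x)) (∣p[x]≔false∣ p x x∈p)

∣p-x∣<∣p∣ : ∀ {V} (p : Subset V) x → lookup p x ≡ true → ∣ p - x ∣ < ∣ p ∣
∣p-x∣<∣p∣ p x x∈p = x∈p⇒∣p-x∣<∣p∣ (lookup⇒[]= x p x∈p)

⟦⟧≡true⇒≡ : ∀ {V} {σ τ : Subset V} → ⟦ τ ⟧ σ ≡ true → σ ≡ τ
⟦⟧≡true⇒≡ {σ = σ} {τ} p with ≡-dec _≟ᵇ_ σ τ
... | yes σ≡τ = σ≡τ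

⟦⟧-apart : ∀ {V} {σ τ : Subset V} x → lookup σ x ≢ lookup τ x → ⟦ τ ⟧ σ ≡ false
⟦⟧-apart {σ = σ} {τ} x differ with ≡-dec _≟ᵇ_ σ τ
... | yes refl = ⊥-elim (differ refl)
... | no _     = refl

⟦⟧-cong : ∀ {V} {σ τ σ′ τ′ : Subset V} →
  (σ ≡ τ → σ′ ≡ τ′) → (σ′ ≡ τ′ → σ ≡ τ) → ⟦ τ ⟧ σ ≡ ⟦ τ′ ⟧ σ′
⟦⟧-cong {σ = σ} {τ} {σ′} {τ′} to from with ≡-dec _≟ᵇ_ σ τ | ≡-dec _≟ᵇ_ σ′ τ′
... | yes _   | yes _    = refl
... | no _    | no _     = refl
... | yes σ≡τ | no σ′≢τ′ = ⊥-elim (σ′≢τ′ (to σ≡τ))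
... | no σ≢τ  | yes σ′≡τ′ = ⊥-elim (σ≢τ (from σ′≡τ′))

∂-xor : ∀ {V} (a b : Chain V) σ → ∂ (λ ρ → a ρ xor b ρ) σ ≡ ∂ a σ xor ∂ b σ
∂-xor {V} a b σ =
  trans (xorSum-cong {V} (λ v → ∧-distribˡ-xor (v∉σ v) (a (σ [ v ]≔ true)) (b (σ [ v ]≔ true))))
        (xorSum-xor (λ v → v∉σ v ∧ a (σ [ v ]≔ true)) (λ v → v∉σ v ∧ b (σ [ v ]≔ true)))
  where
  v∉σ = λ v → not (lookup σ v)

∂-xorSum : ∀ {V} (w : Fin V → Bool) (c : Fin V → Chain V) σ →
  ∂ (λ ρ → xorSum (λ v → w v ∧ c v ρ)) σ ≡ xorSum (λ v → w v ∧ ∂ (c v) σ)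
∂-xorSum {V} w c σ = begin
  xorSum (λ u → u∉σ u ∧ xorSum (λ v → w v ∧ c v (σ [ u ]≔ true)))
    ≡⟨ xorSum-cong {V} (λ u → sym (xorSum-∧ (u∉σ u) (λ v → w v ∧ c v (σ [ u ]≔ true)))) ⟩
  xorSum (λ u → xorSum (λ v → u∉σ u ∧ (w v ∧ c v (σ [ u ]≔ true))))
    ≡⟨ xorSum-swap (λ u v → u∉σ u ∧ (w v ∧ c v (σ [ u ]≔ true))) ⟩
  xorSum (λ v → xorSum (λ u → u∉σ u ∧ (w v ∧ c v (σ [ u ]≔ true))))
    ≡⟨ xorSum-cong {V} (λ v → xorSum-cong {V} (λ u → ∧-lcomm (u∉σ u) (w v) _)) ⟩
  xorSum (λ v → xorSum (λ u → w v ∧ (u∉σ u ∧ c v (σ [ u ]≔ true))))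
    ≡⟨ xorSum-cong {V} (λ v → xorSum-∧ (w v) (λ u → u∉σ u ∧ c v (σ [ u ]≔ true))) ⟩
  xorSum (λ v → w v ∧ ∂ (c v) σ) ∎
  where
  open ≡-Reasoning
  u∉σ = λ u → not (lookup σ u)

-- For u ∉ σ and u ∈ τ, adding u to σ gives τ exactly when σ is τ with u removed.
∂⟦⟧-term : ∀ {V} (σ τ : Subset V) u →
  not (lookup σ u) ∧ ⟦ τ ⟧ (σ [ u ]≔ true) ≡ lookup τ u ∧ ⟦ τ - u ⟧ σ
∂⟦⟧-term σ τ u with lookup σ u in u∈σ | lookup τ u in u∈τ
... | true  | true  = sym (⟦⟧-apart u λ eq → true≢false (trans (sym u∈σ) (trans eq (lookup-x[p-x] τ u))))
... | true  | false = refl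
... | false | false = ⟦⟧-apart u λ eq → true≢false (trans (sym (lookup∘update u σ true)) (trans eq u∈τ))
... | false | true  = ⟦⟧-cong added⇒removed removed⇒added
  where
  open ≡-Reasoning
  added⇒removed : σ [ u ]≔ true ≡ τ → σ ≡ τ - u
  added⇒removed eq = begin
    σ                            ≡⟨ sym ([]≔-lookup σ u) ⟩
    σ [ u ]≔ lookup σ u          ≡⟨ cong (σ [ u ]≔_) u∈σ ⟩
    σ [ u ]≔ false               ≡⟨ sym ([]≔-idempotent σ u) ⟩
    (σ [ u ]≔ true) [ u ]≔ false ≡⟨ cong (_[ u ]≔ false) eq ⟩
    τ [ u ]≔ false               ≡⟨ sym (p-x≡p[x]≔false τ u) ⟩
    τ - u                        ∎
  removed⇒added : σ ≡ τ - u → σ [ u ]≔ true ≡ τ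
  removed⇒added eq = begin
    σ [ u ]≔ true                ≡⟨ cong (_[ u ]≔ true) (trans eq (p-x≡p[x]≔false τ u)) ⟩
    (τ [ u ]≔ false) [ u ]≔ true ≡⟨ []≔-idempotent τ u ⟩
    τ [ u ]≔ true                ≡⟨ cong (τ [ u ]≔_) (sym u∈τ) ⟩
    τ [ u ]≔ lookup τ u          ≡⟨ []≔-lookup τ u ⟩
    τ                            ∎

∂⟦⟧ : ∀ {V} (τ σ : Subset V) → ∂ ⟦ τ ⟧ σ ≡ xorSum (λ v → lookup τ v ∧ ⟦ τ - v ⟧ σ)
∂⟦⟧ τ σ = xorSum-cong (∂⟦⟧-term σ τ)

InC-mono : ∀ {V d} {Y Z : Complex V} {c : Chain V} → Y ≤ᶜ Z → InC d Y c → InC d Z c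
InC-mono Y≤Z c∈Y σ cσ = let σ∈Y , ∣σ∣≡d = c∈Y σ cσ in Y≤Z σ σ∈Y , ∣σ∣≡d

InC-⟦⟧ : ∀ {V} {Y : Complex V} τ → face Y τ ≡ true → InC ∣ τ ∣ Y ⟦ τ ⟧
InC-⟦⟧ τ τ∈Y σ σ=τ with ⟦⟧≡true⇒≡ σ=τ
... | refl = τ∈Y , refl

InC-xor : ∀ {V d} {Y : Complex V} {a b : Chain V} → InC d Y a → InC d Y b → InC d Y (λ σ → a σ xor b σ)
InC-xor {a = a} {b} a∈Y b∈Y σ sσ with xor≡true (a σ) (b σ) sσ
... | inj₁ aσ = a∈Y σ aσ
... | inj₂ bσ = b∈Y σ bσ

InC-xorSum : ∀ {V W d} {Y : Complex V} (c : Fin W → Chain V) →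
  (∀ v → InC d Y (c v)) → InC d Y (λ σ → xorSum (λ v → c v σ))
InC-xorSum c c∈Y σ sσ = let v , cvσ = xorSum≡true⇒∃ (λ v → c v σ) sσ in c∈Y v σ cvσ

InC-∧ : ∀ {V d} {Y : Complex V} a {c : Chain V} → (a ≡ true → InC d Y c) → InC d Y (λ σ → a ∧ c σ)
InC-∧ true c∈Y = c∈Y refl
InC-∧ false c∈Y σ ()

fillingBoundary : ∀ {V} → (Subset V → Chain V) → Subset V → Chain V
fillingBoundary c τ σ = ⟦ τ ⟧ σ xor xorSum (λ v → lookup τ v ∧ c (τ - v) σ)

IsFilling : ∀ {V} → (Subset V → Chain V) → Subset V → Set
IsFilling c τ = ∀ σ → ∂ (c τ) σ ≡ fillingBoundary c τ σ

fillingBoundary-cong : ∀ {V} {c c′ : Subset V → Chain V} τ →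
  (∀ v → lookup τ v ≡ true → c (τ - v) ≡ c′ (τ - v)) →
  ∀ σ → fillingBoundary c τ σ ≡ fillingBoundary c′ τ σ
fillingBoundary-cong {V} {c} {c′} τ facets-agree σ = cong (⟦ τ ⟧ σ xor_) (xorSum-cong {V} term)
  where
  term : ∀ v → lookup τ v ∧ c (τ - v) σ ≡ lookup τ v ∧ c′ (τ - v) σ
  term v with lookup τ v in v∈τ
  ... | false = refl
  ... | true  = cong (λ b → b σ) (facets-agree v v∈τ)

-- Each codimension-2 face τ - v - w = τ - w - v occurs twice.
xorSum-facets-of-facets≡false : ∀ {V} (τ : Subset V) (g : Subset V → Bool) →
  xorSum (λ v → lookup τ v ∧ xorSum (λ w → lookup (τ - v) w ∧ g (τ - v - w))) ≡ false
xorSum-facets-of-facets≡false {V} τ g =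
  trans (xorSum-cong {V} (λ v → sym (xorSum-∧ (lookup τ v) (λ w → lookup (τ - v) w ∧ g (τ - v - w)))))
        (xorSum-symmetric≡false f f-sym f-diag)
  where
  open ≡-Reasoning
  f : Fin V → Fin V → Bool
  f v w = lookup τ v ∧ (lookup (τ - v) w ∧ g (τ - v - w))
  f-diag : ∀ v → f v v ≡ false
  f-diag v = trans (cong (λ b → lookup τ v ∧ (b ∧ g (τ - v - v))) (lookup-x[p-x] τ v)) (∧-zeroʳ (lookup τ v))
  f-sym : ∀ v w → f v w ≡ f w v
  f-sym v w with v Fin.≟ w
  ... | yes refl = refl
  ... | no v≢w = begin
    lookup τ v ∧ (lookup (τ - v) w ∧ g (τ - v - w))
      ≡⟨ cong₂ (λ b ρ → lookup τ v ∧ (b ∧ g ρ)) (lookup-y[p-x] τ (v≢w ∘ sym)) (p─x─y≡p─y─x τ v w) ⟩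
    lookup τ v ∧ (lookup τ w ∧ g (τ - w - v))
      ≡⟨ ∧-lcomm (lookup τ v) (lookup τ w) _ ⟩
    lookup τ w ∧ (lookup τ v ∧ g (τ - w - v))
      ≡⟨ cong (λ b → lookup τ w ∧ (b ∧ g (τ - w - v))) (sym (lookup-y[p-x] τ v≢w)) ⟩
    lookup τ w ∧ (lookup (τ - w) v ∧ g (τ - w - v)) ∎

∂-fillingBoundary≡false : ∀ {V} (c : Subset V → Chain V) τ →
  (∀ v → lookup τ v ≡ true → IsFilling c (τ - v)) →
  ∀ σ → ∂ (fillingBoundary c τ) σ ≡ false
∂-fillingBoundary≡false {V} c τ facets-filled σ = begin
  ∂ (fillingBoundary c τ) σ
    ≡⟨ ∂-xor ⟦ τ ⟧ (λ ρ → xorSum (λ v → lookup τ v ∧ c (τ - v) ρ)) σ ⟩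
  ∂ ⟦ τ ⟧ σ xor ∂ (λ ρ → xorSum (λ v → lookup τ v ∧ c (τ - v) ρ)) σ
    ≡⟨ cong₂ _xor_ (∂⟦⟧ τ σ) (∂-xorSum (lookup τ) (λ v → c (τ - v)) σ) ⟩
  facets xor xorSum (λ v → lookup τ v ∧ ∂ (c (τ - v)) σ)
    ≡⟨ cong (facets xor_) (xorSum-cong {V} ∂-facet) ⟩
  facets xor xorSum (λ v → lookup τ v ∧ ⟦ τ - v ⟧ σ xor lookup τ v ∧ deeper v)
    ≡⟨ cong (facets xor_) (xorSum-xor (λ v → lookup τ v ∧ ⟦ τ - v ⟧ σ) (λ v → lookup τ v ∧ deeper v)) ⟩
  facets xor (facets xor xorSum (λ v → lookup τ v ∧ deeper v))
    ≡⟨ xor-cancelˡ facets _ ⟩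
  xorSum (λ v → lookup τ v ∧ deeper v)
    ≡⟨ xorSum-facets-of-facets≡false τ (λ ρ → c ρ σ) ⟩
  false ∎
  where
  open ≡-Reasoning
  facets = xorSum (λ v → lookup τ v ∧ ⟦ τ - v ⟧ σ)
  deeper : Fin V → Bool
  deeper v = xorSum (λ w → lookup (τ - v) w ∧ c (τ - v - w) σ)
  ∂-facet : ∀ v →
    lookup τ v ∧ ∂ (c (τ - v)) σ ≡ (lookup τ v ∧ ⟦ τ - v ⟧ σ xor lookup τ v ∧ deeper v)
  ∂-facet v with lookup τ v in v∈τ
  ... | false = refl
  ... | true  = facets-filled v v∈τ σ

InC-fillingBoundary : ∀ {V} {Y : Complex V} (c : Subset V → Chain V) τ → face Y τ ≡ true →
  (∀ v → lookup τ v ≡ true → InC (suc ∣ τ - v ∣) Y (c (τ - v))) →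
  InC ∣ τ ∣ Y (fillingBoundary c τ)
InC-fillingBoundary {Y = Y} c τ τ∈Y facets∈Y = InC-xor {Y = Y} (InC-⟦⟧ {Y = Y} τ τ∈Y) facetSum∈Y
  where
  facet∈Y : ∀ v → InC ∣ τ ∣ Y (λ σ → lookup τ v ∧ c (τ - v) σ)
  facet∈Y v = InC-∧ {Y = Y} (lookup τ v) λ v∈τ →
    subst (λ d → InC d Y (c (τ - v))) (∣p-x∣+1≡∣p∣ τ v v∈τ) (facets∈Y v v∈τ)
  facetSum∈Y : InC ∣ τ ∣ Y (λ σ → xorSum (λ v → lookup τ v ∧ c (τ - v) σ))
  facetSum∈Y = InC-xorSum {Y = Y} (λ v σ → lookup τ v ∧ c (τ - v) σ) facet∈Y

module Fillings {V} (X : Complex V) (n : ℕ) (B : Subset V → Complex V)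
  (B-mem     : ∀ τ → face X τ ≡ true → ∣ τ ∣ ≤ n → face (B τ) τ ≡ true)
  (B-mono    : ∀ τ τ′ → face X τ′ ≡ true → ∣ τ′ ∣ ≤ n → τ ⊆ τ′ → B τ ≤ᶜ B τ′)
  (B-acyclic : ∀ τ → face X τ ≡ true → ∣ τ ∣ ≤ n → ReducedHomologyVanishes (B τ) ∣ τ ∣)
  where

  Carried : (Subset V → Chain V) → Subset V → Set
  Carried c τ = InC (suc ∣ τ ∣) (B τ) (c τ) × IsFilling c τ

  CarriedBelow : ℕ → Set
  CarriedBelow k = ∃ λ (c : Subset V → Chain V) →
    ∀ τ → face X τ ≡ true → ∣ τ ∣ ≤ n → ∣ τ ∣ < k → Carried c τ

  fill : ∀ c τ → face X τ ≡ true → ∣ τ ∣ ≤ n →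
    (∀ v → lookup τ v ≡ true → Carried c (τ - v)) →
    ∃ λ b → InC (suc ∣ τ ∣) (B τ) b × (∀ σ → ∂ b σ ≡ fillingBoundary c τ σ)
  fill c τ τ∈X τ≤n facets-carried =
    B-acyclic τ τ∈X τ≤n (fillingBoundary c τ)
      (InC-fillingBoundary {Y = B τ} c τ (B-mem τ τ∈X τ≤n) facet∈B)
      (∂-fillingBoundary≡false c τ (λ v v∈τ → proj₂ (facets-carried v v∈τ)))
    where
    facet∈B : ∀ v → lookup τ v ≡ true → InC (suc ∣ τ - v ∣) (B τ) (c (τ - v))
    facet∈B v v∈τ = InC-mono {Y = B (τ - v)} {Z = B τ} (B-mono (τ - v) τ τ∈X τ≤n (p-x⊆p τ v))
                             (proj₁ (facets-carried v v∈τ))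

  InLayer : ℕ → Subset V → Set
  InLayer k τ = face X τ ≡ true × ∣ τ ∣ ≤ n × ∣ τ ∣ ≡ k

  inLayer? : ∀ k τ → Dec (InLayer k τ)
  inLayer? k τ = (face X τ ≟ᵇ true) ×-dec ((∣ τ ∣ ≤? n) ×-dec (∣ τ ∣ ≟ℕ k))

  -- Only the chains on the faces of size k are replaced, so the facets of any face of
  -- size ≤ k keep their chains and the old boundary equations stay valid.
  extend : ∀ k → CarriedBelow k → CarriedBelow (suc k)
  extend k (c , c-carried) = c′ , c′-carried
    where
    filling : ∀ τ → InLayer k τ →
      ∃ λ b → InC (suc ∣ τ ∣) (B τ) b × (∀ σ → ∂ b σ ≡ fillingBoundary c τ σ)
    filling τ (τ∈X , τ≤n , ∣τ∣≡k) = fill c τ τ∈X τ≤n λ v v∈τ →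
      c-carried (τ - v) (downClose X τ∈X (p-x⊆p τ v)) (≤-trans (p⊆q⇒∣p∣≤∣q∣ (p-x⊆p τ v)) τ≤n)
                (subst (∣ τ - v ∣ <_) ∣τ∣≡k (∣p-x∣<∣p∣ τ v v∈τ))

    choose : ∀ τ → Dec (InLayer k τ) → Chain V
    choose τ (yes τ∈k) = proj₁ (filling τ τ∈k)
    choose τ (no _)    = c τ

    c′ : Subset V → Chain V
    c′ τ = choose τ (inLayer? k τ)

    choose-off : ∀ τ d → ∣ τ ∣ ≢ k → choose τ d ≡ c τ
    choose-off τ (yes (_ , _ , ∣τ∣≡k)) ∣τ∣≢k = ⊥-elim (∣τ∣≢k ∣τ∣≡k)
    choose-off τ (no _)                 _     = refl

    choose-on : ∀ τ d → InLayer k τ →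
      InC (suc ∣ τ ∣) (B τ) (choose τ d) × (∀ σ → ∂ (choose τ d) σ ≡ fillingBoundary c τ σ)
    choose-on τ (yes τ∈k) _   = proj₂ (filling τ τ∈k)
    choose-on τ (no τ∉k)  τ∈k = ⊥-elim (τ∉k τ∈k)

    facets-unchanged : ∀ τ → ∣ τ ∣ ≤ k → ∀ σ → fillingBoundary c τ σ ≡ fillingBoundary c′ τ σ
    facets-unchanged τ ∣τ∣≤k = fillingBoundary-cong {c = c} {c′ = c′} τ λ v v∈τ →
      sym (choose-off (τ - v) (inLayer? k (τ - v)) (<⇒≢ (<-≤-trans (∣p-x∣<∣p∣ τ v v∈τ) ∣τ∣≤k)))

    c′-carried : ∀ τ → face X τ ≡ true → ∣ τ ∣ ≤ n → ∣ τ ∣ < suc k → Carried c′ τ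
    c′-carried τ τ∈X τ≤n ∣τ∣<1+k with m≤n⇒m<n∨m≡n (≤-pred ∣τ∣<1+k)
    ... | inj₂ ∣τ∣≡k =
      let b∈B , ∂b = choose-on τ (inLayer? k τ) (τ∈X , τ≤n , ∣τ∣≡k)
      in b∈B , λ σ → trans (∂b σ) (facets-unchanged τ (≤-reflexive ∣τ∣≡k) σ)
    ... | inj₁ ∣τ∣<k =
      let c∈B , ∂c = c-carried τ τ∈X τ≤n ∣τ∣<k
          unchanged = choose-off τ (inLayer? k τ) (<⇒≢ ∣τ∣<k)
      in subst (InC (suc ∣ τ ∣) (B τ)) (sym unchanged) c∈B ,
         λ σ → trans (cong (λ b → ∂ b σ) unchanged)
                     (trans (∂c σ) (facets-unchanged τ (<⇒≤ ∣τ∣<k) σ))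

  carriedBelow : ∀ k → CarriedBelow k
  carriedBelow zero    = (λ _ _ → false) , λ _ _ _ ()
  carriedBelow (suc k) = extend k (carriedBelow k)

  carried : ∃ λ c → ∀ τ → face X τ ≡ true → ∣ τ ∣ ≤ n → Carried c τ
  carried = let c , c-carried = carriedBelow (suc n) in
    c , λ τ τ∈X τ≤n → c-carried τ τ∈X τ≤n (s≤s τ≤n)

proposition2p1 : ∀ {V n m} (𝔅 : BuildingLike V n m) →
    let open BuildingLike 𝔅 in
    ∃ λ (c : Fin m → Subset V → Chain V) →
      ∀ s τ → face X τ ≡ true → ∣ τ ∣ ≤ n →
        InC (suc ∣ τ ∣) (B s τ) (c s τ)
        × (∀ σ → ∂ (c s τ) σ ≡
                 (⟦ τ ⟧ σ xor xorSum (λ v → lookup τ v ∧ c s (τ - v) σ)))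
proposition2p1 {n = n} {m} 𝔅 = (λ s → proj₁ (F.carried s)) , λ s → proj₂ (F.carried s)
  where
  open BuildingLike 𝔅
  module F (s : Fin m) =
    Fillings X n (B s) (B-mem s) (B-mono s) (λ τ τ∈X τ≤n → C3 s τ τ∈X τ≤n ∣ τ ∣ ≤-refl)
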